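{- Let $\boxplus^n q=\boxplus_1\boxplus_2\cdots\boxplus_n q$ be an LTL' boxed formula with $n\geqslant 0$ boxed operators in front of the atom $q$, each $\boxplus_i\in\{G,\widehat{G}_{s,s'},X\}$. Then for every model and every path $w$: $w\vDash\boxplus^n q$ if and only if for all paths $v$, $R^n(w,v)$ implies $v\vDash q$, where $R^n=R_{\boxplus^n}$ is the accessibility relation defined below.
   Context: Paths, $\leqslant$, $<$, $\mathbf{S}$ (successor: drop the first state), assignments and the semantics of LTL' are as follows. A transition system $T=(S,\to)$ with $\to$ serial; $W$ its set of infinite paths; $w\leqslant v$ iff $v$ is a suffix of $w$ (starting at some index $i\geqslant1$), $w<v$ iff $w\leqslant v$ and $w\neq v$; $\mathbf{S}(s_1,s_2,\ldots)=s_2,s_3,\ldots$. Assignments $h:Prop\to2^S$ with $w\vDash q$ iff the first state of $w$ is in $h(q)$; $w\vDash G\phi$ iff $v\vDash\phi$ for all $v\geqslant w$; $w\vDash\widehat{G}_{s,s'}\phi$ iff $u\vDash\phi$ for all $u$ with $s\leqslant u<s'$ (here $s\neq s'$ denote paths); $w\vDash X\phi$ iff $\mathbf{S}(w)\vDash\phi$. Accessibility relation $R_{\boxplus^n}$, by induction on $n$: $R^0(w,v)$ iff $w=v$. If $\boxplus^{n+1}q=G\boxplus^n q$, then $R_{\boxplus^{n+1}}(w,v)$ iff for some $u$, $w\leqslant u$ and $R_{\boxplus^n}(u,v)$. If $\boxplus^{n+1}q=X\boxplus^n q$, then $R_{\boxplus^{n+1}}(w,v)$ iff $R_{\boxplus^n}(\mathbf{S}(w),v)$.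 If $\boxplus^{n+1}q=\widehat{G}_{s,s'}\boxplus^n q$, then $R_{\boxplus^{n+1}}(w,v)$ iff for some $u$, $s\leqslant u<s'$ and $R_{\boxplus^n}(u,v)$. -}

module Defs where

open import Data.Nat using (ℕ; zero; suc; _+_)
open import Data.Product using (Σ; ∃; _×_; _,_)
open import Data.List using (List; []; _∷_)
open import Relation.Binary.PropositionalEquality using (_≡_)
open import Relation.Nullary using (¬_)

record TS : Set₁ where
  field
    State  : Set
    _⟶_    : State → State → Set
    serial : ∀ s → ∃ λ s′ → s ⟶ s′

module _ (T : TS) where
  open TS T

  -- Infinite paths s₁ s₂ … with sᵢ ⟶ sᵢ₊₁ (index 0 here = s₁ of the paper).
  record Path : Set where
    constructor mkPath
    field
      seq   : ℕ → State
      valid : ∀ i → seq i ⟶ seq (suc i)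
  open Path public

  _≈_ : Path → Path → Set
  w ≈ v = ∀ i → seq w i ≡ seq v i

  _≤ₚ_ : Path → Path → Set
  w ≤ₚ v = Σ ℕ λ k → ∀ j → seq v j ≡ seq w (k + j)

  _<ₚ_ : Path → Path → Set
  w <ₚ v = (w ≤ₚ v) × ¬ (w ≈ v)

  𝐒 : Path → Path
  𝐒 w = mkPath (λ i → seq w (suc i)) (λ i → valid w (suc i))

  data Formula (Prop : Set) : Set where
    atom : Prop → Formula Prop
    G    : Formula Prop → Formula Prop
    Ĝ    : (s s′ : Path) → ¬ (s ≈ s′) → Formula Prop → Formula Prop
    X    : Formula Prop → Formula Prop

  _,_⊨_ : {Prop : Set} → (Prop → State → Set) → Path → Formula Prop → Set
  h , w ⊨ atom q        = h q (seq w 0)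
  h , w ⊨ G φ           = ∀ v → w ≤ₚ v → h , v ⊨ φ
  h , w ⊨ Ĝ s s′ _ φ    = ∀ u → s ≤ₚ u → u <ₚ s′ → h , u ⊨ φ
  h , w ⊨ X φ           = h , 𝐒 w ⊨ φ

  data Box : Set where
    G□ : Box
    Ĝ□ : (s s′ : Path) → ¬ (s ≈ s′) → Box
    X□ : Box

  -- ⊞₁ ⊞₂ ⋯ ⊞ₙ q  (list head = outermost operator ⊞₁).
  boxed : {Prop : Set} → List Box → Prop → Formula Prop
  boxed []             q = atom q
  boxed (G□ ∷ bs)      q = G (boxed bs q)
  boxed (Ĝ□ s s′ p ∷ bs) q = Ĝ s s′ p (boxed bs q)
  boxed (X□ ∷ bs)      q = X (boxed bs q)

  R : List Box → Path → Path → Set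
  R []               w v = w ≈ v
  R (G□ ∷ bs)        w v = Σ Path λ u → (w ≤ₚ u) × R bs u v
  R (Ĝ□ s s′ _ ∷ bs) w v = Σ Path λ u → (s ≤ₚ u) × (u <ₚ s′) × R bs u v
  R (X□ ∷ bs)        w v = R bs (𝐒 w) v

{-# OPTIONS --safe #-}
module Submission where

open import Defs
open import Data.List using (List; []; _∷_)
open import Data.Product using (_×_; _,_)
open import Relation.Binary.PropositionalEquality using (refl; subst)

-- Each boxed operator is a universal modality whose one-step accessibility
-- relation is exactly the clause of R for it, so the equivalence follows by
-- induction on the list of operators. At the atom, R⁰ is equality of paths,
-- and atoms only see the first state.

module _ (T : TS) {Prop : Set} (h : Prop → TS.State T → Set) where

  Valid : List (Box T) → Prop → Path T → Set
  Valid bs q w = ∀ v → R T bs w v → _,_⊨_ T h v (atom q)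

  ⊨-atom-resp-≈ : ∀ q w v → _≈_ T w v → _,_⊨_ T h w (atom q) → _,_⊨_ T h v (atom q)
  ⊨-atom-resp-≈ q w v w≈v = subst (h q) (w≈v 0)

  ⊨-boxed⇒Valid : ∀ bs q w → _,_⊨_ T h w (boxed T bs q) → Valid bs q w
  ⊨-boxed⇒Valid [] q w w⊨q v w≈v =
    ⊨-atom-resp-≈ q w v w≈v w⊨q
  ⊨-boxed⇒Valid (G□ ∷ bs) q w w⊨ v (u , w≤u , Ruv) =
    ⊨-boxed⇒Valid bs q u (w⊨ u w≤u) v Ruv
  ⊨-boxed⇒Valid (Ĝ□ s s′ _ ∷ bs) q w w⊨ v (u , s≤u , u<s′ , Ruv) =
    ⊨-boxed⇒Valid bs q u (w⊨ u s≤u u<s′) v Ruv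
  ⊨-boxed⇒Valid (X□ ∷ bs) q w w⊨ =
    ⊨-boxed⇒Valid bs q (𝐒 T w) w⊨

  Valid⇒⊨-boxed : ∀ bs q w → Valid bs q w → _,_⊨_ T h w (boxed T bs q)
  Valid⇒⊨-boxed [] q w valid =
    valid w (λ _ → refl)
  Valid⇒⊨-boxed (G□ ∷ bs) q w valid u w≤u =
    Valid⇒⊨-boxed bs q u (λ v Ruv → valid v (u , w≤u , Ruv))
  Valid⇒⊨-boxed (Ĝ□ s s′ _ ∷ bs) q w valid u s≤u u<s′ =
    Valid⇒⊨-boxed bs q u (λ v Ruv → valid v (u , s≤u , u<s′ , Ruv))
  Valid⇒⊨-boxed (X□ ∷ bs) q w valid =
    Valid⇒⊨-boxed bs q (𝐒 T w) valid

lemma3p2 : (T : TS) {Prop : Set} (h : Prop → TS.State T → Set)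
    (bs : List (Box T)) (q : Prop) (w : Path T) →
    ((_,_⊨_ T h w (boxed T bs q)) → (∀ v → R T bs w v → _,_⊨_ T h v (atom q)))
    × ((∀ v → R T bs w v → _,_⊨_ T h v (atom q)) → _,_⊨_ T h w (boxed T bs q))
lemma3p2 T h bs q w = ⊨-boxed⇒Valid T h bs q w , Valid⇒⊨-boxed T h bs q w
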